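{- Let $\mathbb{F}_q$ be a finite field, $n,d\geq 1$ integers, $A\in\mathrm{GL}_{n+1}(\mathbb{F}_q)$ a diagonal matrix and $\lambda\in\mathbb{F}_q$. If $A$ is not a scalar multiple of the identity matrix $I_{n+1}$, then $$\dim \mathcal{P}^{A,\lambda}\leq \frac{1}{2}\binom{d+n-1}{n-1}+\frac{1}{2}\binom{d+n}{n}.$$
   Context: $\mathcal{P}_d$ is the $\mathbb{F}_q$-vector space of homogeneous polynomials of degree $d$ in $\mathbb{F}_q[x_1,\dots,x_{n+1}]$. For $A\in\mathrm{GL}_{n+1}(\mathbb{F}_q)$ and $\lambda\in\mathbb{F}_q$, $\mathcal{P}^{A,\lambda}=\{f\in\mathcal{P}_d : \lambda f = f\circ A\}$, where $f\circ A$ is the polynomial obtained by substituting $A(x_1,\dots,x_{n+1})^t$ for $(x_1,\dots,x_{n+1})$. -}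

module Defs where

open import Level using (Level; _⊔_)
open import Algebra.Bundles using (CommutativeRing)
open import Data.Nat using (ℕ; zero; suc) renaming (_+_ to _+ℕ_)
open import Data.Fin using (Fin) renaming (_≟_ to _≟F_)
open import Data.Vec using (Vec; replicate; zipWith; lookup; toList; tabulate)
open import Data.Vec.Properties using (≡-dec)
import Data.Nat as ℕ
open import Data.List using (List; []; _∷_; map; concatMap; foldr; allFin; _++_)
open import Data.Nat.ListAction using (sum)
open import Data.List.Relation.Unary.Any using (Any)
open import Data.Product using (_×_; _,_; ∃)
open import Data.Bool using (if_then_else_)
open import Relation.Nullary using (¬_; does)
open import Relation.Binary using (Decidable)
open import Relation.Binary.PropositionalEquality using (_≡_; _≢_)

record IsFiniteField {c ℓ : Level} (R : CommutativeRing c ℓ) : Set (c ⊔ ℓ) where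
  open CommutativeRing R
  field
    0≉1      : ¬ (0# ≈ 1#)
    inverse  : ∀ x → ¬ (x ≈ 0#) → ∃ λ y → x * y ≈ 1#
    _≟_      : Decidable _≈_
    elements : List Carrier
    complete : ∀ x → Any (x ≈_) elements

module Poly {c ℓ : Level} (R : CommutativeRing c ℓ) (N : ℕ) where
  open CommutativeRing R

  Exponent : Set
  Exponent = Vec ℕ N

  Term : Set c
  Term = Carrier × Exponent

  Polynomial : Set c
  Polynomial = List Term

  degree : Exponent → ℕ
  degree e = sum (toList e)

  coeff : Polynomial → Exponent → Carrier
  coeff [] e = 0#
  coeff ((a , e′) ∷ p) e =
    if does (≡-dec ℕ._≟_ e′ e) then a + coeff p e else coeff p e

  _≋_ : Polynomial → Polynomial → Set ℓ
  p ≋ q = ∀ e → coeff p e ≈ coeff q e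

  zeroP : Polynomial
  zeroP = []

  oneP : Polynomial
  oneP = (1# , replicate N 0) ∷ []

  scale : Carrier → Polynomial → Polynomial
  scale a p = map (λ { (b , e) → (a * b , e) }) p

  _⊕_ : Polynomial → Polynomial → Polynomial
  p ⊕ q = p ++ q

  _⊗_ : Polynomial → Polynomial → Polynomial
  p ⊗ q = concatMap (λ { (a , e) → map (λ { (b , e′) → (a * b , zipWith _+ℕ_ e e′) }) q }) p

  pow : Polynomial → ℕ → Polynomial
  pow p zero = oneP
  pow p (suc k) = p ⊗ pow p k

  unitExp : Fin N → Exponent
  unitExp i = tabulate (λ j → if does (i ≟F j) then 1 else 0)

  var : Fin N → Polynomial
  var i = (1# , unitExp i) ∷ []

  Matrix : Set c
  Matrix = Fin N → Fin N → Carrier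

  linForm : Matrix → Fin N → Polynomial
  linForm A i = concatMap (λ j → scale (A i j) (var j)) (allFin N)

  substMono : Matrix → Exponent → Polynomial
  substMono A e = foldr _⊗_ oneP (map (λ i → pow (linForm A i) (lookup e i)) (allFin N))

  _∘A_ : Polynomial → Matrix → Polynomial
  f ∘A A = concatMap (λ { (a , e) → scale a (substMono A e) }) f

  Σ[_] : (Fin N → Carrier) → Carrier
  Σ[ g ] = foldr _+_ 0# (map g (allFin N))

  _·_ : Matrix → Matrix → Matrix
  (A · B) i k = Σ[ (λ j → A i j * B j k) ]

  I : Matrix
  I i j = if does (i ≟F j) then 1# else 0#

  _≈M_ : Matrix → Matrix → Set ℓ
  A ≈M B = ∀ i j → A i j ≈ B i j

  IsInvertible : Matrix → Set (c ⊔ ℓ)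
  IsInvertible A = ∃ λ B → ((A · B) ≈M I) × ((B · A) ≈M I)

  IsDiagonal : Matrix → Set ℓ
  IsDiagonal A = ∀ i j → i ≢ j → A i j ≈ 0#

  IsScalarMultipleOfI : Matrix → Set (c ⊔ ℓ)
  IsScalarMultipleOfI A = ∃ λ a → A ≈M (λ i j → a * I i j)

  IsHomogeneous : ℕ → Polynomial → Set ℓ
  IsHomogeneous d f = ∀ e → degree e ≢ d → coeff f e ≈ 0#

  InEigen : ℕ → Matrix → Carrier → Polynomial → Set ℓ
  InEigen d A λ′ f = IsHomogeneous d f × (scale λ′ f ≋ (f ∘A A))

  linComb : {m : ℕ} → (Fin m → Carrier) → (Fin m → Polynomial) → Polynomial
  linComb {m} c v = concatMap (λ k → scale (c k) (v k)) (allFin m)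

  LinearlyIndependent : {m : ℕ} → (Fin m → Polynomial) → Set (c ⊔ ℓ)
  LinearlyIndependent {m} v = ∀ (c : Fin m → Carrier) → linComb c v ≋ zeroP → ∀ k → c k ≈ 0#

{-# OPTIONS --safe #-}
-- For diagonal A with diagonal a, substituting A x into the monomial x^e gives a^e x^e with
-- a^e = ∏ aᵢ^eᵢ, so every f ∈ 𝒫^{A,λ} has its coefficients supported on the exponents e of degree d
-- with a^e = λ, and (by Gaussian elimination on coefficient vectors) a linearly independent family in
-- 𝒫^{A,λ} is no larger than the number S of such e.  The aᵢ are nonzero as A is invertible, and some
-- aⱼ differs from a₀ as A is not scalar.  Splitting the solutions e on whether e₀ = 0, and again on
-- whether eⱼ = 0, bounds 2S by twice the number C(d+n-1, n-1) of monomials of degree d in n variables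
-- plus the number of e′ of degree d - 1 with a₀ a^e′ = λ or aⱼ a^e′ = λ.  These conditions exclude
-- each other, so 2S ≤ 2 C(d+n-1, n-1) + C(d+n-1, n) = C(d+n-1, n-1) + C(d+n, n).

module Submission where

open import Defs
open import Level using (Level; _⊔_)
open import Algebra.Bundles using (CommutativeMonoid; CommutativeRing)
open import Data.Nat as ℕ using (ℕ; zero; suc; _≤_; z≤n; s≤s)
import Data.Nat.Properties as ℕ
import Data.Nat.ListAction as ListAction
open import Data.Nat.Combinatorics using (_C_; nCn≡1; nCk+nC[k+1]≡[n+1]C[k+1])
open import Data.Fin using (Fin; zero; suc; punchIn) renaming (_≟_ to _≟F_)
import Data.Fin.Properties as Fin
open import Data.Vec as Vec using (Vec; []; _∷_; lookup; replicate; zipWith; tabulate)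
import Data.Vec.Properties as Vec
open import Data.Vec.Functional as Vector using (Vector; removeAt; insertAt)
open import Data.Vec.Functional.Properties using (insertAt-lookup; insertAt-punchIn)
open import Data.List as List using (List; []; _∷_; _++_; map; concatMap; filter; length)
import Data.List.Properties as List
open import Data.List.Membership.Propositional using (_∈_; _∉_)
open import Data.List.Membership.Propositional.Properties using (∈-map⁺; ∈-++⁺ˡ; ∈-++⁺ʳ; ∈-filter⁺)
open import Data.List.Relation.Unary.Any using (here; index)
open import Data.List.Relation.Unary.Any.Properties using (lookup-index)
open import Data.List.Relation.Unary.All as All using (All; []; _∷_)
import Data.List.Relation.Unary.All.Properties as All
open import Data.Product using (_,_; proj₁; proj₂; ∃)
open import Data.Sum using (_⊎_; inj₁; inj₂)
open import Data.Bool using (true; false; if_then_else_)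
open import Data.Empty using (⊥-elim)
open import Function using (_∘_; id)
import Relation.Unary
open import Relation.Nullary using (¬_; Dec; does; yes; no)
open import Relation.Nullary.Decidable using (dec-true; dec-false; decidable-stable; ¬?)
open import Relation.Binary.PropositionalEquality as ≡ using (_≡_; _≢_)

module _ {a ℓ} (M : CommutativeMonoid a ℓ) where
  open CommutativeMonoid M
  open import Algebra.Properties.CommutativeMonoid.Sum M

  sum-zero : ∀ {n} (t : Vector Carrier n) → (∀ j → t j ≈ ε) → sum t ≈ ε
  sum-zero {n} t t≈ε = trans (sum-cong-≋ t≈ε) (sum-replicate-zero n)

  sum-single : ∀ {n} (t : Vector Carrier n) i → (∀ j → j ≢ i → t j ≈ ε) → sum t ≈ t i
  sum-single {suc n} t i off = begin
    sum t                     ≈⟨ sum-remove t ⟩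
    t i ∙ sum (removeAt t i)  ≈⟨ ∙-congˡ (sum-zero (removeAt t i) (λ j → off (punchIn i j) (Fin.punchInᵢ≢i i j))) ⟩
    t i ∙ ε                   ≈⟨ identityʳ (t i) ⟩
    t i                       ∎
    where open import Relation.Binary.Reasoning.Setoid setoid

foldr-map-tabulate : ∀ {a b c} {A : Set a} {B : Set b} {C : Set c} {n}
                     (_∙_ : B → C → C) (z : C) (g : A → B) (h : Fin n → A) →
                     List.foldr _∙_ z (map g (List.tabulate h)) ≡ Vector.foldr _∙_ z (g ∘ h)
foldr-map-tabulate {n = zero}  _∙_ z g h = ≡.refl
foldr-map-tabulate {n = suc n} _∙_ z g h = ≡.cong (g (h zero) ∙_) (foldr-map-tabulate _∙_ z g (h ∘ suc))

length-filter-map : ∀ {a b p} {A : Set a} {B : Set b} {P : B → Set p} (P? : Relation.Unary.Decidable P)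
                    (f : A → B) xs → length (filter P? (map f xs)) ≡ length (filter (P? ∘ f) xs)
length-filter-map P? f []       = ≡.refl
length-filter-map P? f (x ∷ xs) with does (P? (f x))
... | true  = ≡.cong suc (length-filter-map P? f xs)
... | false = length-filter-map P? f xs

length-filter-disjoint : ∀ {a p q} {A : Set a} {P : A → Set p} {Q : A → Set q}
                         (P? : Relation.Unary.Decidable P) (Q? : Relation.Unary.Decidable Q) →
                         (∀ {x} → P x → ¬ Q x) → ∀ xs → length (filter P? xs) ℕ.+ length (filter Q? xs) ≤ length xs
length-filter-disjoint P? Q? disjoint []       = z≤n
length-filter-disjoint P? Q? disjoint (x ∷ xs) with P? x | Q? x | length-filter-disjoint P? Q? disjoint xs
... | yes px | yes qx | _  = ⊥-elim (disjoint px qx)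
... | yes _  | no _   | ih = s≤s ih
... | no _   | yes _  | ih = ≡.subst (_≤ suc (length xs)) (≡.sym (ℕ.+-suc _ _)) (s≤s ih)
... | no _   | no _   | ih = ℕ.m≤n⇒m≤1+n ih

raise : ∀ {N} → Vec ℕ (suc N) → Vec ℕ (suc N)
raise (k ∷ e) = suc k ∷ e

exponents : (N d : ℕ) → List (Vec ℕ N)
exponents zero    zero    = [] ∷ []
exponents zero    (suc d) = []
exponents (suc N) zero    = map (0 ∷_) (exponents N zero)
exponents (suc N) (suc d) = map (0 ∷_) (exponents N (suc d)) ++ map raise (exponents (suc N) d)

exponents-complete : ∀ {N} (e : Vec ℕ N) → e ∈ exponents N (ListAction.sum (Vec.toList e))
exponents-complete []            = here ≡.refl
exponents-complete (zero  ∷ e) with ListAction.sum (Vec.toList e) | exponents-complete e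
... | zero  | e∈ = ∈-map⁺ (0 ∷_) e∈
... | suc _ | e∈ = ∈-++⁺ˡ (∈-map⁺ (0 ∷_) e∈)
exponents-complete (suc k ∷ e) = ∈-++⁺ʳ (map (0 ∷_) (exponents _ _)) (∈-map⁺ raise (exponents-complete (k ∷ e)))

length-exponents-zero : ∀ N → length (exponents N zero) ≡ 1
length-exponents-zero zero    = ≡.refl
length-exponents-zero (suc N) = ≡.trans (List.length-map (0 ∷_) (exponents N zero)) (length-exponents-zero N)

length-exponents-suc : ∀ N d → length (exponents (suc N) (suc d)) ≡ length (exponents N (suc d)) ℕ.+ length (exponents (suc N) d)
length-exponents-suc N d =
  ≡.trans (List.length-++ (map (0 ∷_) (exponents N (suc d))))
          (≡.cong₂ ℕ._+_ (List.length-map (0 ∷_) (exponents N (suc d))) (List.length-map raise (exponents (suc N) d)))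

length-exponents : ∀ N d → length (exponents (suc N) d) ≡ (d ℕ.+ N) C N
length-exponents zero    zero    = ≡.refl
length-exponents zero    (suc d) = ≡.trans (length-exponents-suc zero d) (length-exponents zero d)
length-exponents (suc N) zero    = ≡.trans (length-exponents-zero (suc (suc N))) (≡.sym (nCn≡1 (suc N)))
length-exponents (suc N) (suc d) = begin
  length (exponents (suc (suc N)) (suc d))                    ≡⟨ length-exponents-suc (suc N) d ⟩
  length (exponents (suc N) (suc d)) ℕ.+ length (exponents (suc (suc N)) d)
    ≡⟨ ≡.cong₂ ℕ._+_ (length-exponents N (suc d)) (length-exponents (suc N) d) ⟩
  (suc d ℕ.+ N) C N ℕ.+ (d ℕ.+ suc N) C suc N
    ≡⟨ ≡.cong (λ n → n C N ℕ.+ (d ℕ.+ suc N) C suc N) (ℕ.+-suc d N) ⟨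
  (d ℕ.+ suc N) C N ℕ.+ (d ℕ.+ suc N) C suc N                 ≡⟨ nCk+nC[k+1]≡[n+1]C[k+1] (d ℕ.+ suc N) N ⟩
  suc (d ℕ.+ suc N) C suc N                                   ∎
  where open ≡.≡-Reasoning

module Monomials {c ℓ} (R : CommutativeRing c ℓ) where
  open CommutativeRing R hiding (zero)
  open import Algebra.Properties.Semiring.Exp semiring public using (_^_)
  open import Algebra.Properties.Monoid.Sum *-monoid public using () renaming (sum to product)

  evalMonomial : ∀ {N} → Vector Carrier N → Vec ℕ N → Carrier
  evalMonomial a e = product (λ i → a i ^ lookup e i)

module ExponentVectors (N : ℕ) where
  open import Algebra.Properties.CommutativeMonoid.Sum ℕ.+-0-commutativeMonoid using (sum)

  _+ᵉ_ : Vec ℕ N → Vec ℕ N → Vec ℕ N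
  _+ᵉ_ = zipWith ℕ._+_

  0ᵉ : Vec ℕ N
  0ᵉ = replicate N 0

  _·ᵉ_ : ℕ → Vec ℕ N → Vec ℕ N
  zero  ·ᵉ u = 0ᵉ
  suc k ·ᵉ u = u +ᵉ (k ·ᵉ u)

  unit : Fin N → Vec ℕ N
  unit i = tabulate (λ j → if does (i ≟F j) then 1 else 0)

  lookup-·ᵉ : ∀ k u j → lookup (k ·ᵉ u) j ≡ k ℕ.* lookup u j
  lookup-·ᵉ zero    u j = Vec.lookup-replicate j 0
  lookup-·ᵉ (suc k) u j = ≡.trans (Vec.lookup-zipWith ℕ._+_ j u (k ·ᵉ u)) (≡.cong (lookup u j ℕ.+_) (lookup-·ᵉ k u j))

  lookup-·ᵉ-unit : ∀ k i j → lookup (k ·ᵉ unit i) j ≡ (if does (i ≟F j) then k else 0)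
  lookup-·ᵉ-unit k i j =
    ≡.trans (lookup-·ᵉ k (unit i) j) (≡.trans (≡.cong (k ℕ.*_) (Vec.lookup∘tabulate _ j)) (*-if (does (i ≟F j))))
    where
    *-if : ∀ b → k ℕ.* (if b then 1 else 0) ≡ (if b then k else 0)
    *-if true  = ℕ.*-identityʳ k
    *-if false = ℕ.*-zeroʳ k

  lookup-foldr-+ᵉ : ∀ {M} (u : Vector (Vec ℕ N) M) j → lookup (Vector.foldr _+ᵉ_ 0ᵉ u) j ≡ sum (λ i → lookup (u i) j)
  lookup-foldr-+ᵉ {zero}  u j = Vec.lookup-replicate j 0
  lookup-foldr-+ᵉ {suc M} u j =
    ≡.trans (Vec.lookup-zipWith ℕ._+_ j (u zero) _) (≡.cong (lookup (u zero) j ℕ.+_) (lookup-foldr-+ᵉ (u ∘ suc) j))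

  ∑-·ᵉ-unit : ∀ e → Vector.foldr _+ᵉ_ 0ᵉ (λ i → lookup e i ·ᵉ unit i) ≡ e
  ∑-·ᵉ-unit e = ≡.trans (≡.sym (Vec.tabulate∘lookup _)) (≡.trans (Vec.tabulate-cong lookup-∑) (Vec.tabulate∘lookup e))
    where
    open ≡.≡-Reasoning
    lookup-∑ : ∀ j → lookup (Vector.foldr _+ᵉ_ 0ᵉ (λ i → lookup e i ·ᵉ unit i)) j ≡ lookup e j
    lookup-∑ j = begin
      lookup (Vector.foldr _+ᵉ_ 0ᵉ (λ i → lookup e i ·ᵉ unit i)) j
        ≡⟨ lookup-foldr-+ᵉ (λ i → lookup e i ·ᵉ unit i) j ⟩
      sum (λ i → lookup (lookup e i ·ᵉ unit i) j)                  ≡⟨ sum-single ℕ.+-0-commutativeMonoid _ j off ⟩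
      lookup (lookup e j ·ᵉ unit j) j                              ≡⟨ lookup-·ᵉ-unit (lookup e j) j j ⟩
      (if does (j ≟F j) then lookup e j else 0)
        ≡⟨ ≡.cong (if_then lookup e j else 0) (dec-true (j ≟F j) ≡.refl) ⟩
      lookup e j                                                   ∎
      where
      off : ∀ i → i ≢ j → lookup (lookup e i ·ᵉ unit i) j ≡ 0
      off i i≢j = ≡.trans (lookup-·ᵉ-unit (lookup e i) i j) (≡.cong (if_then lookup e i else 0) (dec-false (i ≟F j) i≢j))

module Coefficients {c ℓ} (R : CommutativeRing c ℓ) (N : ℕ) where
  open CommutativeRing R hiding (zero)
  open Poly R N
  open Monomials R
  open ExponentVectors N
  open import Algebra.Properties.CommutativeMonoid.Sum +-commutativeMonoid using (sum; sum-cong-≋)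
  open import Relation.Binary.Reasoning.Setoid setoid

  _≟ᵉ_ : (e f : Exponent) → Dec (e ≡ f)
  _≟ᵉ_ = Vec.≡-dec ℕ._≟_

  diagonal : Matrix → Vector Carrier N
  diagonal A i = A i i

  coeff-++ : ∀ p q e → coeff (p ++ q) e ≈ coeff p e + coeff q e
  coeff-++ []             q e = sym (+-identityˡ _)
  coeff-++ ((b , e′) ∷ p) q e with e′ ≟ᵉ e
  ... | yes _ = trans (+-congˡ (coeff-++ p q e)) (sym (+-assoc _ _ _))
  ... | no  _ = coeff-++ p q e

  coeff-scale : ∀ a p e → coeff (scale a p) e ≈ a * coeff p e
  coeff-scale a []             e = sym (zeroʳ a)
  coeff-scale a ((b , e′) ∷ p) e with e′ ≟ᵉ e
  ... | yes _ = trans (+-congˡ (coeff-scale a p e)) (sym (distribˡ a b _))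
  ... | no  _ = coeff-scale a p e

  additive-concatMap : ∀ {x y} {X : Set x} {Y : Set y} {n} (φ : List X → Carrier) →
                       φ [] ≈ 0# → (∀ p q → φ (p ++ q) ≈ φ p + φ q) →
                       (f : Y → List X) (g : Fin n → Y) →
                       φ (concatMap f (List.tabulate g)) ≈ sum (φ ∘ f ∘ g)
  additive-concatMap {n = zero}  φ φ-[] φ-++ f g = φ-[]
  additive-concatMap {n = suc n} φ φ-[] φ-++ f g =
    trans (φ-++ (f (g zero)) _) (+-congˡ (additive-concatMap φ φ-[] φ-++ f (g ∘ suc)))

  coeff-linComb : ∀ {m} (a : Fin m → Carrier) (v : Fin m → Polynomial) e →
                  coeff (linComb a v) e ≈ sum (λ k → a k * coeff (v k) e)
  coeff-linComb a v e =
    trans (additive-concatMap (λ p → coeff p e) refl (λ p q → coeff-++ p q e) (λ k → scale (a k) (v k)) id)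
          (sum-cong-≋ (λ k → coeff-scale (a k) (v k) e))

  coeffSum : Polynomial → Carrier
  coeffSum []            = 0#
  coeffSum ((b , _) ∷ p) = b + coeffSum p

  coeffSum-++ : ∀ p q → coeffSum (p ++ q) ≈ coeffSum p + coeffSum q
  coeffSum-++ []            q = sym (+-identityˡ _)
  coeffSum-++ ((b , _) ∷ p) q = trans (+-congˡ (coeffSum-++ p q)) (sym (+-assoc _ _ _))

  coeffSum-map : ∀ a (h : Term → Term) → (∀ t → proj₁ (h t) ≈ a * proj₁ t) →
                 ∀ p → coeffSum (map h p) ≈ a * coeffSum p
  coeffSum-map a h h-coeff []      = sym (zeroʳ a)
  coeffSum-map a h h-coeff (t ∷ p) =
    trans (+-cong (h-coeff t) (coeffSum-map a h h-coeff p)) (sym (distribˡ a _ _))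

  mulTerm : Term → Term → Term
  mulTerm (a , e) (b , f) = a * b , e +ᵉ f

  coeffSum-⊗ : ∀ p q → coeffSum (p ⊗ q) ≈ coeffSum p * coeffSum q
  coeffSum-⊗ []      q = sym (zeroˡ _)
  coeffSum-⊗ (t ∷ p) q = begin
    coeffSum ((t ∷ p) ⊗ q)                            ≡⟨⟩
    coeffSum (map (mulTerm t) q ++ p ⊗ q)             ≈⟨ coeffSum-++ (map (mulTerm t) q) (p ⊗ q) ⟩
    coeffSum (map (mulTerm t) q) + coeffSum (p ⊗ q)
      ≈⟨ +-cong (coeffSum-map (proj₁ t) (mulTerm t) (λ _ → refl) q) (coeffSum-⊗ p q) ⟩
    proj₁ t * coeffSum q + coeffSum p * coeffSum q    ≈⟨ distribʳ _ (proj₁ t) _ ⟨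
    coeffSum (t ∷ p) * coeffSum q                     ∎

  AtOrZero : Exponent → Term → Set ℓ
  AtOrZero u (b , e) = e ≡ u ⊎ b ≈ 0#

  -- A term-by-term form of p ≋ (a , u) ∷ []; unlike ≋ it is evidently preserved by _⊗_.
  record IsMonomial (a : Carrier) (u : Exponent) (p : Polynomial) : Set (c ⊔ ℓ) where
    field
      atOrZero : All (AtOrZero u) p
      coeffSum≈ : coeffSum p ≈ a
  open IsMonomial

  AtOrZero-* : ∀ {u v a b e f} → AtOrZero u (a , e) → AtOrZero v (b , f) → AtOrZero (u +ᵉ v) (a * b , e +ᵉ f)
  AtOrZero-* (inj₁ ≡.refl) (inj₁ ≡.refl) = inj₁ ≡.refl
  AtOrZero-* (inj₂ a≈0)    _             = inj₂ (trans (*-congʳ a≈0) (zeroˡ _))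
  AtOrZero-* (inj₁ _)      (inj₂ b≈0)    = inj₂ (trans (*-congˡ b≈0) (zeroʳ _))

  AtOrZero-⊗ : ∀ {u v p q} → All (AtOrZero u) p → All (AtOrZero v) q → All (AtOrZero (u +ᵉ v)) (p ⊗ q)
  AtOrZero-⊗ []         qs = []
  AtOrZero-⊗ (pt ∷ ps) qs = All.++⁺ (All.map⁺ (All.map (AtOrZero-* pt) qs)) (AtOrZero-⊗ ps qs)

  IsMonomial-⊗ : ∀ {a b u v p q} → IsMonomial a u p → IsMonomial b v q → IsMonomial (a * b) (u +ᵉ v) (p ⊗ q)
  IsMonomial-⊗ {p = p} {q} mp mq = record
    { atOrZero  = AtOrZero-⊗ (atOrZero mp) (atOrZero mq)
    ; coeffSum≈ = trans (coeffSum-⊗ p q) (*-cong (coeffSum≈ mp) (coeffSum≈ mq))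
    }

  IsMonomial-oneP : IsMonomial 1# 0ᵉ oneP
  IsMonomial-oneP = record { atOrZero = inj₁ ≡.refl ∷ [] ; coeffSum≈ = +-identityʳ 1# }

  IsMonomial-pow : ∀ {a u p} → IsMonomial a u p → ∀ k → IsMonomial (a ^ k) (k ·ᵉ u) (pow p k)
  IsMonomial-pow mp zero    = IsMonomial-oneP
  IsMonomial-pow mp (suc k) = IsMonomial-⊗ mp (IsMonomial-pow mp k)

  IsMonomial-foldr : ∀ {M} {a : Vector Carrier M} {u : Vector Exponent M} {p : Vector Polynomial M} →
                     (∀ i → IsMonomial (a i) (u i) (p i)) →
                     IsMonomial (product a) (Vector.foldr _+ᵉ_ 0ᵉ u) (Vector.foldr _⊗_ oneP p)
  IsMonomial-foldr {zero}  mp = IsMonomial-oneP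
  IsMonomial-foldr {suc M} mp = IsMonomial-⊗ (mp zero) (IsMonomial-foldr (mp ∘ suc))

  coeff-IsMonomial-at : ∀ {a u p} → IsMonomial a u p → coeff p u ≈ a
  coeff-IsMonomial-at {u = u} mp = trans (coeff-at (atOrZero mp)) (coeffSum≈ mp)
    where
    coeff-at : ∀ {p} → All (AtOrZero u) p → coeff p u ≈ coeffSum p
    coeff-at []                      = refl
    coeff-at {(b , e) ∷ p} (at ∷ ps) with e ≟ᵉ u | at
    ... | yes _ | _          = +-congˡ (coeff-at ps)
    ... | no e≢u | inj₁ e≡u  = ⊥-elim (e≢u e≡u)
    ... | no _  | inj₂ b≈0   = trans (coeff-at ps) (trans (sym (+-identityˡ _)) (+-congʳ (sym b≈0)))

  coeff-IsMonomial-off : ∀ {a u p e} → IsMonomial a u p → e ≢ u → coeff p e ≈ 0#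
  coeff-IsMonomial-off {u = u} {e = e} mp e≢u = coeff-off (atOrZero mp)
    where
    coeff-off : ∀ {p} → All (AtOrZero u) p → coeff p e ≈ 0#
    coeff-off []                       = refl
    coeff-off {(b , e′) ∷ p} (at ∷ ps) with e′ ≟ᵉ e | at
    ... | no _       | _         = coeff-off ps
    ... | yes ≡.refl | inj₁ e≡u  = ⊥-elim (e≢u e≡u)
    ... | yes _      | inj₂ b≈0  = trans (+-cong b≈0 (coeff-off ps)) (+-identityˡ 0#)

  IsMonomial-linForm : ∀ A → IsDiagonal A → ∀ i → IsMonomial (A i i) (unitExp i) (linForm A i)
  IsMonomial-linForm A diag i = record
    { atOrZero  = All.concat⁺ (All.map⁺ (All.tabulate⁺ (λ j → atOrZero-scaled j ∷ [])))
    ; coeffSum≈ = trans (additive-concatMap coeffSum refl coeffSum-++ (λ j → scale (A i j) (var j)) id)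
                        (trans (sum-single +-commutativeMonoid _ i off) (trans (+-identityʳ _) (*-identityʳ _)))
    }
    where
    atOrZero-scaled : ∀ j → AtOrZero (unitExp i) (A i j * 1# , unitExp j)
    atOrZero-scaled j with i ≟F j
    ... | yes ≡.refl = inj₁ ≡.refl
    ... | no  i≢j    = inj₂ (trans (*-identityʳ _) (diag i j i≢j))
    off : ∀ j → j ≢ i → A i j * 1# + 0# ≈ 0#
    off j j≢i = trans (+-identityʳ _) (trans (*-identityʳ _) (diag i j (j≢i ∘ ≡.sym)))

  IsMonomial-substMono : ∀ A → IsDiagonal A → ∀ e → IsMonomial (evalMonomial (diagonal A) e) e (substMono A e)
  IsMonomial-substMono A diag e =
    ≡.subst₂ (IsMonomial _) (∑-·ᵉ-unit e) (≡.sym (foldr-map-tabulate _⊗_ oneP factor id))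
             (IsMonomial-foldr (λ i → IsMonomial-pow (IsMonomial-linForm A diag i) (lookup e i)))
    where
    factor : Fin N → Polynomial
    factor i = pow (linForm A i) (lookup e i)

  coeff-∘A-diagonal : ∀ A → IsDiagonal A → ∀ f e → coeff (f ∘A A) e ≈ evalMonomial (diagonal A) e * coeff f e
  coeff-∘A-diagonal A diag []             e = sym (zeroʳ _)
  coeff-∘A-diagonal A diag ((b , e′) ∷ f) e with e′ ≟ᵉ e
  ... | yes ≡.refl = begin
    coeff (((b , e) ∷ f) ∘A A) e                     ≡⟨⟩
    coeff (scale b (substMono A e) ++ f ∘A A) e      ≈⟨ coeff-++ (scale b (substMono A e)) (f ∘A A) e ⟩
    coeff (scale b (substMono A e)) e + coeff (f ∘A A) e
      ≈⟨ +-cong (trans (coeff-scale b (substMono A e) e) (*-congˡ (coeff-IsMonomial-at (IsMonomial-substMono A diag e))))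
                (coeff-∘A-diagonal A diag f e) ⟩
    b * μ + μ * coeff f e                              ≈⟨ +-congʳ (*-comm b μ) ⟩
    μ * b + μ * coeff f e                              ≈⟨ distribˡ μ b _ ⟨
    μ * (b + coeff f e)                                ∎
    where μ = evalMonomial (diagonal A) e
  ... | no e′≢e = begin
    coeff (((b , e′) ∷ f) ∘A A) e                    ≡⟨⟩
    coeff (scale b (substMono A e′) ++ f ∘A A) e     ≈⟨ coeff-++ (scale b (substMono A e′)) (f ∘A A) e ⟩
    coeff (scale b (substMono A e′)) e + coeff (f ∘A A) e
      ≈⟨ +-cong (trans (coeff-scale b (substMono A e′) e)
                       (*-congˡ (coeff-IsMonomial-off (IsMonomial-substMono A diag e′) (e′≢e ∘ ≡.sym))))
                (coeff-∘A-diagonal A diag f e) ⟩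
    b * 0# + μ * coeff f e                             ≈⟨ +-congʳ (zeroʳ b) ⟩
    0# + μ * coeff f e                                 ≈⟨ +-identityˡ _ ⟩
    μ * coeff f e                                      ∎
    where μ = evalMonomial (diagonal A) e

module FieldProperties {c ℓ} {F : CommutativeRing c ℓ} (isField : IsFiniteField F) where
  open CommutativeRing F hiding (zero)
  open IsFiniteField isField
  open Monomials F
  open import Algebra.Properties.Ring ring using (-‿distribˡ-*)
  open import Algebra.Properties.Semiring.Sum semiring using (sum; sum-cong-≋; sum-remove; ∑-distrib-+; *-distribʳ-sum)
  open import Relation.Binary.Reasoning.Setoid setoid

  *-cancelʳ-≉0 : ∀ {x y z} → ¬ z ≈ 0# → x * z ≈ y * z → x ≈ y
  *-cancelʳ-≉0 {x} {y} {z} z≉0 xz≈yz with inverse z z≉0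
  ... | z⁻¹ , zz⁻¹≈1 = begin
    x              ≈⟨ *-identityʳ x ⟨
    x * 1#         ≈⟨ *-congˡ zz⁻¹≈1 ⟨
    x * (z * z⁻¹)  ≈⟨ *-assoc x z z⁻¹ ⟨
    x * z * z⁻¹    ≈⟨ *-congʳ xz≈yz ⟩
    y * z * z⁻¹    ≈⟨ *-assoc y z z⁻¹ ⟩
    y * (z * z⁻¹)  ≈⟨ *-congˡ zz⁻¹≈1 ⟩
    y * 1#         ≈⟨ *-identityʳ y ⟩
    y              ∎

  *-≉0 : ∀ {x y} → ¬ x ≈ 0# → ¬ y ≈ 0# → ¬ x * y ≈ 0#
  *-≉0 x≉0 y≉0 xy≈0 = x≉0 (*-cancelʳ-≉0 y≉0 (trans xy≈0 (sym (zeroˡ _))))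

  1≉0 : ¬ 1# ≈ 0#
  1≉0 = 0≉1 ∘ sym

  ^-≉0 : ∀ {x} → ¬ x ≈ 0# → ∀ k → ¬ x ^ k ≈ 0#
  ^-≉0 x≉0 zero    = 1≉0
  ^-≉0 x≉0 (suc k) = *-≉0 x≉0 (^-≉0 x≉0 k)

  evalMonomial-≉0 : ∀ {N} {a : Vector Carrier N} → (∀ i → ¬ a i ≈ 0#) → ∀ e → ¬ evalMonomial a e ≈ 0#
  evalMonomial-≉0 a≉0 []      = 1≉0
  evalMonomial-≉0 a≉0 (k ∷ e) = *-≉0 (^-≉0 (a≉0 zero) k) (evalMonomial-≉0 (a≉0 ∘ suc) e)

  Independent : ∀ {m K} → (Fin m → Fin K → Carrier) → Set (c ⊔ ℓ)
  Independent {m} w = ∀ (x : Fin m → Carrier) → (∀ s → sum (λ k → x k * w k s) ≈ 0#) → ∀ k → x k ≈ 0#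

  independent-tail : ∀ {m K} {w : Fin m → Fin (suc K) → Carrier} →
                     (∀ k → w k zero ≈ 0#) → Independent w → Independent (λ k s → w k (suc s))
  independent-tail w₀≈0 indep x comb = indep x λ
    { zero    → sum-zero +-commutativeMonoid _ (λ k → trans (*-congˡ (w₀≈0 k)) (zeroʳ _))
    ; (suc s) → comb s
    }

  module Elimination {m K} (w : Fin (suc m) → Fin K → Carrier) (s₀ : Fin K) (k₀ : Fin (suc m))
                     {p⁻¹ : Carrier} (pp⁻¹≈1 : w k₀ s₀ * p⁻¹ ≈ 1#) where
    ratio : Fin m → Carrier
    ratio j = w (punchIn k₀ j) s₀ * p⁻¹

    eliminate : Fin m → Fin K → Carrier
    eliminate j s = w (punchIn k₀ j) s - ratio j * w k₀ s

    eliminate-pivot : ∀ j → eliminate j s₀ ≈ 0#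
    eliminate-pivot j = begin
      b - b * p⁻¹ * p        ≈⟨ +-congˡ (-‿cong (*-assoc b p⁻¹ p)) ⟩
      b - b * (p⁻¹ * p)      ≈⟨ +-congˡ (-‿cong (*-congˡ (trans (*-comm p⁻¹ p) pp⁻¹≈1))) ⟩
      b - b * 1#             ≈⟨ +-congˡ (-‿cong (*-identityʳ b)) ⟩
      b - b                  ≈⟨ -‿inverseʳ b ⟩
      0#                     ∎
      where
      b = w (punchIn k₀ j) s₀
      p = w k₀ s₀

    independent-eliminate : Independent w → Independent eliminate
    independent-eliminate indep y comb j = begin
      y j                    ≡⟨ insertAt-punchIn y k₀ α j ⟨
      x (punchIn k₀ j)       ≈⟨ indep x (λ s → trans (combination s) (comb s)) (punchIn k₀ j) ⟩
      0#                     ∎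
      where
      α = sum (λ j → y j * - ratio j)
      x = insertAt y k₀ α
      combination : ∀ s → sum (λ k → x k * w k s) ≈ sum (λ j → y j * eliminate j s)
      combination s = begin
        sum (λ k → x k * w k s)                                      ≈⟨ sum-remove {i = k₀} (λ k → x k * w k s) ⟩
        x k₀ * w k₀ s + sum (λ j → x (punchIn k₀ j) * w (punchIn k₀ j) s)
          ≈⟨ +-cong (*-congʳ (reflexive (insertAt-lookup y k₀ α)))
                    (sum-cong-≋ (λ j → *-congʳ (reflexive (insertAt-punchIn y k₀ α j)))) ⟩
        α * w k₀ s + sum (λ j → y j * w (punchIn k₀ j) s)            ≈⟨ +-comm _ _ ⟩
        sum (λ j → y j * w (punchIn k₀ j) s) + α * w k₀ s
          ≈⟨ +-congˡ (*-distribʳ-sum (w k₀ s) (λ j → y j * - ratio j)) ⟩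
        sum (λ j → y j * w (punchIn k₀ j) s) + sum (λ j → y j * - ratio j * w k₀ s)
          ≈⟨ ∑-distrib-+ (λ j → y j * w (punchIn k₀ j) s) (λ j → y j * - ratio j * w k₀ s) ⟨
        sum (λ j → y j * w (punchIn k₀ j) s + y j * - ratio j * w k₀ s)
          ≈⟨ sum-cong-≋ (λ j → expand (y j) _ (ratio j) _) ⟨
        sum (λ j → y j * eliminate j s)                              ∎
        where
        expand : ∀ a b r z → a * (b - r * z) ≈ a * b + a * - r * z
        expand a b r z = trans (distribˡ a b _) (+-congˡ (trans (*-congˡ (-‿distribˡ-* r z)) (sym (*-assoc a (- r) z))))

  independent⇒≤ : ∀ {m K} (w : Fin m → Fin K → Carrier) → Independent w → m ≤ K
  independent⇒≤ {zero}          _ _     = z≤n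
  independent⇒≤ {suc m} {zero}  w indep = ⊥-elim (1≉0 (indep (λ _ → 1#) (λ ()) zero))
  independent⇒≤ {suc m} {suc K} w indep with Fin.any? (λ k → ¬? (w k zero ≟ 0#))
  ... | no noPivot = ℕ.m≤n⇒m≤1+n (independent⇒≤ (λ k s → w k (suc s)) (independent-tail {w = w} column₀≈0 indep))
    where
    column₀≈0 : ∀ k → w k zero ≈ 0#
    column₀≈0 k = decidable-stable (w k zero ≟ 0#) (λ wk≉0 → noPivot (k , wk≉0))
  ... | yes (k₀ , p≉0) with inverse (w k₀ zero) p≉0
  ...   | _ , pp⁻¹≈1 = s≤s (independent⇒≤ (λ j s → eliminate j (suc s))
                                          (independent-tail eliminate-pivot (independent-eliminate indep)))
    where open Elimination w zero k₀ pp⁻¹≈1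

module Counting {c ℓ} {F : CommutativeRing c ℓ} (isField : IsFiniteField F) (λ′ : CommutativeRing.Carrier F) where
  open CommutativeRing F hiding (zero; _+_)
  open import Data.Nat using (_+_)
  open IsFiniteField isField
  open Monomials F
  open FieldProperties isField
  open import Algebra.Properties.CommutativeSemigroup ℕ.+-commutativeSemigroup using (x∙yz≈y∙xz; interchange)

  IsSolution : ∀ {N} → Vector Carrier N → Carrier → Vec ℕ N → Set ℓ
  IsSolution a c e = c * evalMonomial a e ≈ λ′

  isSolution? : ∀ {N} (a : Vector Carrier N) c → Relation.Unary.Decidable (IsSolution a c)
  isSolution? a c e = (c * evalMonomial a e) ≟ λ′

  solutions : ∀ {N} → Vector Carrier N → Carrier → ℕ → List (Vec ℕ N)
  solutions {N} a c d = filter (isSolution? a c) (exponents N d)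

  #solutions : ∀ {N} → Vector Carrier N → Carrier → ℕ → ℕ
  #solutions a c d = length (solutions a c d)

  #solutions-≤ : ∀ {N} (a : Vector Carrier N) c d → #solutions a c d ≤ length (exponents N d)
  #solutions-≤ {N} a c d = List.length-filter (isSolution? a c) (exponents N d)

  #solutions-map : ∀ {N M} {a : Vector Carrier N} {b : Vector Carrier M} {c c′} (f : Vec ℕ M → Vec ℕ N) →
                   (∀ e → c * evalMonomial a (f e) ≈ c′ * evalMonomial b e) → ∀ es →
                   length (filter (isSolution? a c) (map f es)) ≡ length (filter (isSolution? b c′) es)
  #solutions-map {a = a} {b} {c} {c′} f eq es =
    ≡.trans (length-filter-map (isSolution? a c) f es)
            (≡.cong length (List.filter-≐ (isSolution? a c ∘ f) (isSolution? b c′)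
                                          ((λ {e} h → trans (sym (eq e)) h) , (λ {e} h → trans (eq e) h)) es))

  #solutions-cong : ∀ {N} (a : Vector Carrier N) {c c′} → c ≈ c′ → ∀ d → #solutions a c d ≡ #solutions a c′ d
  #solutions-cong {N} a {c} {c′} c≈c′ d =
    ≡.cong length (List.filter-≐ (isSolution? a c) (isSolution? a c′)
                                 ((λ h → trans (*-congʳ (sym c≈c′)) h) , (λ h → trans (*-congʳ c≈c′) h)) (exponents N d))

  #solutions-zero : ∀ {N} (a : Vector Carrier (suc N)) c → #solutions a c 0 ≡ #solutions (a ∘ suc) c 0
  #solutions-zero {N} a c = #solutions-map {a = a} {a ∘ suc} (0 ∷_) (λ e → *-congˡ (*-identityˡ _)) (exponents N 0)

  #solutions-suc : ∀ {N} (a : Vector Carrier (suc N)) c d →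
                   #solutions a c (suc d) ≡ #solutions (a ∘ suc) c (suc d) + #solutions a (c * a zero) d
  #solutions-suc {N} a c d =
    ≡.trans (≡.cong length (List.filter-++ (isSolution? a c) (map (0 ∷_) (exponents N (suc d))) _))
    (≡.trans (List.length-++ (filter (isSolution? a c) (map (0 ∷_) (exponents N (suc d)))))
             (≡.cong₂ _+_ (#solutions-map {a = a} {a ∘ suc} (0 ∷_) (λ e → *-congˡ (*-identityˡ _)) (exponents N (suc d)))
                            (#solutions-map {a = a} {a} raise raised (exponents (suc N) d))))
    where
    raised : ∀ e → c * evalMonomial a (raise e) ≈ (c * a zero) * evalMonomial a e
    raised (k ∷ e) = trans (*-congˡ (*-assoc (a zero) _ _)) (sym (*-assoc c (a zero) _))

  #solutions-degree-zero : ∀ {N M} (a : Vector Carrier N) (b : Vector Carrier M) c → #solutions a c 0 ≡ #solutions b c 0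
  #solutions-degree-zero a b c = ≡.trans (to-no-variables a) (≡.sym (to-no-variables b))
    where
    to-no-variables : ∀ {N} (a : Vector Carrier N) → #solutions a c 0 ≡ #solutions {0} (λ ()) c 0
    to-no-variables {zero}  a = ≡.refl
    to-no-variables {suc N} a = ≡.trans (#solutions-zero a c) (to-no-variables (a ∘ suc))

  -- Split on whether eᵢ = 0; if not, e minus the i-th unit vector is a solution for c * a i.
  #solutions-removeAt : ∀ {N} (a : Vector Carrier (suc N)) i c d →
                        #solutions a c (suc d) ≡ #solutions (removeAt a i) c (suc d) + #solutions a (c * a i) d
  #solutions-removeAt         a zero    c d = #solutions-suc a c d
  #solutions-removeAt {suc N} a (suc i) c d = begin
    #solutions a c (suc d)                                      ≡⟨ #solutions-suc a c d ⟩
    #solutions (a ∘ suc) c (suc d) + #solutions a (c * a₀) d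
      ≡⟨ ≡.cong (_+ #solutions a (c * a₀) d) (#solutions-removeAt (a ∘ suc) i c d) ⟩
    (R + #solutions (a ∘ suc) (c * aᵢ) d) + #solutions a (c * a₀) d  ≡⟨ ℕ.+-assoc R _ _ ⟩
    R + (#solutions (a ∘ suc) (c * aᵢ) d + #solutions a (c * a₀) d)  ≡⟨ ≡.cong (R +_) (exchange d) ⟩
    R + (#solutions a∖i (c * a₀) d + #solutions a (c * aᵢ) d)        ≡⟨ ℕ.+-assoc R _ _ ⟨
    (R + #solutions a∖i (c * a₀) d) + #solutions a (c * aᵢ) d
      ≡⟨ ≡.cong (_+ #solutions a (c * aᵢ) d) (#solutions-suc a∖i c d) ⟨
    #solutions a∖i c (suc d) + #solutions a (c * aᵢ) d               ∎
    where
    open ≡.≡-Reasoning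
    a₀ = a zero
    aᵢ = a (suc i)
    a∖i = removeAt a (suc i)
    R = #solutions (removeAt (a ∘ suc) i) c (suc d)
    exchange : ∀ d → #solutions (a ∘ suc) (c * aᵢ) d + #solutions a (c * a₀) d
                   ≡ #solutions a∖i (c * a₀) d + #solutions a (c * aᵢ) d
    exchange zero    = ≡.trans (≡.cong₂ _+_ (#solutions-degree-zero (a ∘ suc) a _) (#solutions-degree-zero a a∖i _))
                               (ℕ.+-comm (#solutions a (c * aᵢ) 0) (#solutions a∖i (c * a₀) 0))
    exchange (suc d) = begin
      X + #solutions a (c * a₀) (suc d)                   ≡⟨ ≡.cong (X +_) (#solutions-removeAt a (suc i) (c * a₀) d) ⟩
      X + (Y + #solutions a (c * a₀ * aᵢ) d)              ≡⟨ x∙yz≈y∙xz X Y _ ⟩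
      Y + (X + #solutions a (c * a₀ * aᵢ) d)              ≡⟨ ≡.cong (λ n → Y + (X + n)) (#solutions-cong a swap d) ⟩
      Y + (X + #solutions a (c * aᵢ * a₀) d)              ≡⟨ ≡.cong (Y +_) (#solutions-suc a (c * aᵢ) d) ⟨
      Y + #solutions a (c * aᵢ) (suc d)                   ∎
      where
      X = #solutions (a ∘ suc) (c * aᵢ) (suc d)
      Y = #solutions a∖i (c * a₀) (suc d)
      swap : c * a₀ * aᵢ ≈ c * aᵢ * a₀
      swap = trans (*-assoc c _ _) (trans (*-congˡ (*-comm a₀ aᵢ)) (sym (*-assoc c _ _)))

  #solutions-disjoint : ∀ {N} {a : Vector Carrier N} → (∀ i → ¬ a i ≈ 0#) → ∀ {c c′} → ¬ c ≈ c′ → ∀ d →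
                        #solutions a c d + #solutions a c′ d ≤ length (exponents N d)
  #solutions-disjoint {N} {a} a≉0 {c} {c′} c≉c′ d =
    length-filter-disjoint (isSolution? a c) (isSolution? a c′)
      (λ {e} cμ≈λ c′μ≈λ → c≉c′ (*-cancelʳ-≉0 (evalMonomial-≉0 a≉0 e) (trans cμ≈λ (sym c′μ≈λ))))
      (exponents N d)

  #solutions-bound : ∀ {N} (a : Vector Carrier (suc N)) → (∀ i → ¬ a i ≈ 0#) → ∀ {j} → ¬ a zero ≈ a j → ∀ d →
                     #solutions a 1# d + #solutions a 1# d ≤ length (exponents (suc N) d) + length (exponents N d)
  #solutions-bound a a≉0 a₀≉aⱼ zero =
    ℕ.+-mono-≤ (#solutions-≤ a 1# 0) (≡.subst (_≤ _) (≡.sym (#solutions-zero a 1#)) (#solutions-≤ (a ∘ suc) 1# 0))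
  #solutions-bound {N} a a≉0 {j} a₀≉aⱼ (suc d) = begin
    #solutions a 1# (suc d) + #solutions a 1# (suc d)
      ≡⟨ ≡.cong₂ _+_ (#solutions-removeAt a zero 1# d) (#solutions-removeAt a j 1# d) ⟩
    (R₀ + S₀) + (Rⱼ + Sⱼ)                     ≡⟨ interchange R₀ S₀ Rⱼ Sⱼ ⟩
    (R₀ + Rⱼ) + (S₀ + Sⱼ)
      ≤⟨ ℕ.+-mono-≤ (ℕ.+-mono-≤ (#solutions-≤ (removeAt a zero) 1# (suc d)) (#solutions-≤ (removeAt a j) 1# (suc d)))
                    (#solutions-disjoint a≉0 (a₀≉aⱼ ∘ *-cancelˡ-1) d) ⟩
    (T + T) + length (exponents (suc N) d)    ≡⟨ ℕ.+-assoc T T _ ⟩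
    T + (T + length (exponents (suc N) d))    ≡⟨ ≡.cong (T +_) (length-exponents-suc N d) ⟨
    T + length (exponents (suc N) (suc d))    ≡⟨ ℕ.+-comm T _ ⟩
    length (exponents (suc N) (suc d)) + T    ∎
    where
    open ℕ.≤-Reasoning
    R₀ = #solutions (removeAt a zero) 1# (suc d)
    Rⱼ = #solutions (removeAt a j) 1# (suc d)
    S₀ = #solutions a (1# * a zero) d
    Sⱼ = #solutions a (1# * a j) d
    T  = length (exponents N (suc d))
    *-cancelˡ-1 : ∀ {x y} → 1# * x ≈ 1# * y → x ≈ y
    *-cancelˡ-1 h = trans (sym (*-identityˡ _)) (trans h (*-identityˡ _))

module Eigenvectors {c ℓ} {F : CommutativeRing c ℓ} (isField : IsFiniteField F) (N : ℕ) where
  open CommutativeRing F hiding (zero)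
  open IsFiniteField isField
  open Poly F N
  open Monomials F
  open Coefficients F N
  open FieldProperties isField
  open import Algebra.Properties.CommutativeMonoid.Sum +-commutativeMonoid using (sum)
  open import Data.List.Membership.DecPropositional _≟ᵉ_ using (_∈?_)
  open import Relation.Binary.Reasoning.Setoid setoid

  diagonal-≉0 : ∀ A → IsInvertible A → IsDiagonal A → ∀ i → ¬ A i i ≈ 0#
  diagonal-≉0 A (B , AB≈I , _) diag i Aᵢᵢ≈0 = 0≉1 (begin
    0#                           ≈⟨ sum-zero +-commutativeMonoid _ (λ j → trans (*-congʳ (row≈0 j)) (zeroˡ _)) ⟨
    sum (λ j → A i j * B j i)    ≡⟨ foldr-map-tabulate _+_ 0# (λ j → A i j * B j i) id ⟨
    (A · B) i i                  ≈⟨ AB≈I i i ⟩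
    I i i                        ≡⟨ ≡.cong (if_then 1# else 0#) (dec-true (i ≟F i) ≡.refl) ⟩
    1#                           ∎)
    where
    row≈0 : ∀ j → A i j ≈ 0#
    row≈0 j with i ≟F j
    ... | yes ≡.refl = Aᵢᵢ≈0
    ... | no  i≢j    = diag i j i≢j

  homogeneous-degree : ∀ {d f e} → IsHomogeneous d f → ¬ coeff f e ≈ 0# → degree e ≡ d
  homogeneous-degree {d} {e = e} hom fₑ≉0 = decidable-stable (degree e ℕ.≟ d) (λ deg≢d → fₑ≉0 (hom e deg≢d))

  eigen-evalMonomial : ∀ {A λ′ f e} → IsDiagonal A → scale λ′ f ≋ (f ∘A A) → ¬ coeff f e ≈ 0# →
                       evalMonomial (diagonal A) e ≈ λ′
  eigen-evalMonomial {A} {λ′} {f} {e} diag eigen fₑ≉0 = *-cancelʳ-≉0 fₑ≉0 (begin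
    evalMonomial (diagonal A) e * coeff f e   ≈⟨ coeff-∘A-diagonal A diag f e ⟨
    coeff (f ∘A A) e                          ≈⟨ eigen e ⟨
    coeff (scale λ′ f) e                      ≈⟨ coeff-scale λ′ f e ⟩
    λ′ * coeff f e                            ∎)

  independent-coefficients : ∀ {m} {v : Fin m → Polynomial} (S : List Exponent) →
                             (∀ k e → e ∉ S → coeff (v k) e ≈ 0#) → LinearlyIndependent v →
                             Independent (λ k s → coeff (v k) (List.lookup S s))
  independent-coefficients {v = v} S outside≈0 indep x comb =
    indep x (λ e → trans (coeff-linComb x v e) (combination≈0 e))
    where
    combination≈0 : ∀ e → sum (λ k → x k * coeff (v k) e) ≈ 0#
    combination≈0 e with e ∈? S
    ... | yes e∈S =
      ≡.subst (λ e′ → sum (λ k → x k * coeff (v k) e′) ≈ 0#) (≡.sym (lookup-index e∈S)) (comb (index e∈S))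
    ... | no  e∉S = sum-zero +-commutativeMonoid _ (λ k → trans (*-congˡ (outside≈0 k e e∉S)) (zeroʳ _))

  non-scalar⇒distinct-diagonal : ∀ {A} → IsDiagonal A → ¬ IsScalarMultipleOfI A → ∀ i → ∃ λ j → ¬ A i i ≈ A j j
  non-scalar⇒distinct-diagonal {A} diag non-scalar i with Fin.any? (λ j → ¬? (A i i ≟ A j j))
  ... | yes distinct = distinct
  ... | no  constant = ⊥-elim (non-scalar (A i i , scalar))
    where
    scalar : ∀ j k → A j k ≈ A i i * I j k
    scalar j k with j ≟F k
    ... | yes ≡.refl = trans (sym (decidable-stable (A i i ≟ A j j) (λ ≉ → constant (j , ≉)))) (sym (*-identityʳ _))
    ... | no  j≢k    = trans (diag j k j≢k) (sym (zeroʳ _))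

  module _ (λ′ : Carrier) where
    open Counting isField λ′

    independent-eigenvectors-≤ : ∀ {d A m} {v : Fin m → Polynomial} → IsDiagonal A →
                                 (∀ k → InEigen d A λ′ (v k)) → LinearlyIndependent v →
                                 m ≤ #solutions (diagonal A) 1# d
    independent-eigenvectors-≤ {d} {A} {v = v} diag eigen indep =
      independent⇒≤ _ (independent-coefficients (solutions (diagonal A) 1# d) outside≈0 indep)
      where
      outside≈0 : ∀ k e → e ∉ solutions (diagonal A) 1# d → coeff (v k) e ≈ 0#
      outside≈0 k e e∉S with coeff (v k) e ≟ 0#
      ... | yes vₖₑ≈0 = vₖₑ≈0
      ... | no  vₖₑ≉0 = ⊥-elim (e∉S (∈-filter⁺ (isSolution? (diagonal A) 1#) e∈exponents is-solution))
        where
        e∈exponents : e ∈ exponents N d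
        e∈exponents = ≡.subst (λ d′ → e ∈ exponents N d′) (homogeneous-degree {f = v k} (proj₁ (eigen k)) vₖₑ≉0)
                              (exponents-complete e)
        is-solution : 1# * evalMonomial (diagonal A) e ≈ λ′
        is-solution = trans (*-identityˡ _) (eigen-evalMonomial {f = v k} {e} diag (proj₂ (eigen k)) vₖₑ≉0)

open import Data.Nat using (_+_; _*_; _∸_)

lemma7 : ∀ {c ℓ : Level} (F : CommutativeRing c ℓ) → IsFiniteField F →
         (n d : ℕ) → 1 ≤ n → 1 ≤ d →
         (A : Poly.Matrix F (suc n)) → Poly.IsInvertible F (suc n) A →
         Poly.IsDiagonal F (suc n) A →
         (λ′ : CommutativeRing.Carrier F) →
         ¬ Poly.IsScalarMultipleOfI F (suc n) A →
         (m : ℕ) (v : Fin m → Poly.Polynomial F (suc n)) →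
         (∀ k → Poly.InEigen F (suc n) d A λ′ (v k)) →
         Poly.LinearlyIndependent F (suc n) v →
         2 * m ≤ ((d + n ∸ 1) C (n ∸ 1)) + ((d + n) C n)
lemma7 F isField (suc n) d _ _ A invertible diag λ′ non-scalar m v eigen indep = begin
  2 * m
    ≤⟨ ℕ.*-monoʳ-≤ 2 (independent-eigenvectors-≤ λ′ diag eigen indep) ⟩
  2 * #S
    ≡⟨ ≡.cong (#S +_) (ℕ.+-identityʳ #S) ⟩
  #S + #S
    ≤⟨ #solutions-bound (diagonal A) (diagonal-≉0 A invertible diag) a₀≉aⱼ d ⟩
  length (exponents (suc (suc n)) d) + length (exponents (suc n) d)
    ≡⟨ ℕ.+-comm (length (exponents (suc (suc n)) d)) _ ⟩
  length (exponents (suc n) d) + length (exponents (suc (suc n)) d)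
    ≡⟨ ≡.cong₂ _+_ (≡.trans (length-exponents n d) (≡.cong (λ k → (k ∸ 1) C n) (≡.sym (ℕ.+-suc d n))))
                   (length-exponents (suc n) d) ⟩
  (d + suc n ∸ 1) C n + (d + suc n) C suc n
    ∎
  where
  open ℕ.≤-Reasoning
  open Coefficients F (suc (suc n)) using (diagonal)
  open Eigenvectors isField (suc (suc n))
  open Counting isField λ′
  #S = #solutions (diagonal A) (CommutativeRing.1# F) d
  a₀≉aⱼ = proj₂ (non-scalar⇒distinct-diagonal diag non-scalar zero)
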